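{- Work in Bishop-style constructive mathematics. For each fan $T$, the principle $\Pi^0_1$-$\mathrm{FAN}_{\mathrm{M}}(T)$ ("every monotone $\Pi^0_1$ bar of $T$ is uniform") is equivalent to the principle $\Pi^0_1$-$\mathrm{FAN}^{*}_{\mathrm{M}}(T)$ ("every monotone $\Pi^0_1$ bar of the universal spread $\mathbb{N}^*$ is uniform with respect to $T$").
   Context: $\mathbb{N}^*$ is the set of finite sequences of natural numbers, $a*b$ concatenation, $\overline{\alpha}n$ the initial segment of length $n$ of $\alpha\in\mathbb{N}^{\mathbb{N}}$. A tree is an inhabited decidable subset of $\mathbb{N}^*$ closed under initial segments. A spread is a tree $T$ with $\forall a\in T\,\exists n\,(a*\langle n\rangle\in T)$; a path of $T$ is $\alpha$ with $\forall n\,(\overline{\alpha}n\in T)$. A fan is a spread $T$ with $\forall a\in T\,\exists N\,\forall n\,[a*\langle n\rangle\in T\to n\le N]$. For a spread $T$, $P\subseteq T$ is a bar of $T$ if every path $\alpha$ of $T$ has some $n$ with $\overline{\alpha}n\in P$; a uniform bar if there is $N$ such that every path of $T$ has some $n\le N$ with $\overline{\alpha}n\in P$; $\Pi^0_1$ if $P=\bigcap_n B_n$ with each $B_n\subseteq T$ decidable; monotone if $a\in P$, $a*b\in T$ imply $a*b\in P$. The universal spread is $\mathbb{N}^*$ itself. For a fan $T$, a bar $P$ of $\mathbb{N}^*$ is uniform with respect to $T$ if $P\cap T$ is a uniform bar of $T$. -}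

module Defs where

open import Data.Nat using (ℕ; zero; suc; _≤_)
open import Data.Bool using (Bool; true)
open import Data.List using (List; []; _∷_; _++_; [_])
open import Data.Product using (Σ; _×_; ∃; ∃-syntax; _,_)
open import Function.Bundles using (_⇔_)
open import Relation.Binary.PropositionalEquality using (_≡_)

-- Finite sequences of naturals: List ℕ.  Concatenation a * b is a ++ b.
Seq : Set
Seq = List ℕ

initSeg : (ℕ → ℕ) → ℕ → Seq
initSeg α zero    = []
initSeg α (suc n) = initSeg α n ++ [ α n ]

DecSubset : Set
DecSubset = Seq → Bool

_∈ᵈ_ : Seq → DecSubset → Set
a ∈ᵈ T = T a ≡ true

record IsTree (T : DecSubset) : Set where
  field
    inhabited : ∃[ a ] (a ∈ᵈ T)
    closed    : ∀ a b → (a ++ b) ∈ᵈ T → a ∈ᵈ T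

record IsSpread (T : DecSubset) : Set where
  field
    isTree : IsTree T
    extend : ∀ a → a ∈ᵈ T → ∃[ n ] ((a ++ [ n ]) ∈ᵈ T)

record IsFan (T : DecSubset) : Set where
  field
    isSpread : IsSpread T
    bounded  : ∀ a → a ∈ᵈ T → ∃[ N ] (∀ n → (a ++ [ n ]) ∈ᵈ T → n ≤ N)

record Fan : Set where
  field
    tree  : DecSubset
    isFan : IsFan tree

universal : DecSubset
universal _ = true

IsPath : DecSubset → (ℕ → ℕ) → Set
IsPath T α = ∀ n → initSeg α n ∈ᵈ T

Subset : Set₁
Subset = Seq → Set

_⊆_ : Subset → DecSubset → Set
P ⊆ T = ∀ a → P a → a ∈ᵈ T

_∩ᵈ_ : Subset → DecSubset → Subset
(P ∩ᵈ T) a = P a × (a ∈ᵈ T)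

IsBar : DecSubset → Subset → Set
IsBar T P = P ⊆ T × (∀ α → IsPath T α → ∃[ n ] P (initSeg α n))

IsUniformBar : DecSubset → Subset → Set
IsUniformBar T P =
  P ⊆ T × (∃[ N ] (∀ α → IsPath T α → ∃[ n ] (n ≤ N × P (initSeg α n))))

IsΠ⁰₁ : DecSubset → Subset → Set
IsΠ⁰₁ T P = Σ (ℕ → DecSubset) λ B →
  (∀ n a → a ∈ᵈ B n → a ∈ᵈ T) × (∀ a → P a ⇔ (∀ n → a ∈ᵈ B n))

IsMonotone : DecSubset → Subset → Set
IsMonotone T P = ∀ a b → P a → (a ++ b) ∈ᵈ T → P (a ++ b)

Π⁰₁-FAN-M : DecSubset → Set₁
Π⁰₁-FAN-M T = (P : Subset) → IsΠ⁰₁ T P → IsMonotone T P → IsBar T P → IsUniformBar T P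

Π⁰₁-FAN*-M : DecSubset → Set₁
Π⁰₁-FAN*-M T = (P : Subset) → IsΠ⁰₁ universal P → IsMonotone universal P →
  IsBar universal P → IsUniformBar T (P ∩ᵈ T)

module Submission where

-- (⇒) needs nothing about T: if P is a monotone Π⁰₁ bar of ℕ*, then P ∩ T
--     is a monotone Π⁰₁ bar of T (intersect each Bₙ with T; a path of T is
--     a path of ℕ*), so Π⁰₁-FAN_M(T) makes it uniform.
-- (⇐) only uses that T is a spread.  Given a monotone Π⁰₁ bar P of T we
--     form its completion P ∪ ∁T.  It is Π⁰₁ (Cₙ = "a ∈ T implies a ∈ Bₙ")
--     and monotone (∁T is closed upwards since T is a tree).  It bars ℕ*:
--     we retract every α onto a path β of T, which agrees with α for as
--     long as α stays inside T; P bars β, so either α meets P along β or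
--     α has already left T.  Π⁰₁-FAN*_M(T) makes (P ∪ ∁T) ∩ T a uniform bar
--     of T, and (P ∪ ∁T) ∩ T ⊆ P, so P is uniform as well.

open import Defs
open import Function.Bundles using (_⇔_; mk⇔; Equivalence)
open import Data.Nat using (ℕ; zero; suc; _≤_)
open import Data.Bool using (true; false; not; _∧_; _∨_; _≟_)
open import Data.Bool.Properties using (∧-conicalˡ; ∧-conicalʳ; ∨-zeroʳ)
open import Data.List using ([]; _++_; [_])
open import Data.Product using (∃-syntax; _,_; proj₁; proj₂)
open import Data.Sum using (_⊎_; inj₁; inj₂)
open import Relation.Nullary using (¬_; Dec; yes; no; contradiction)
open import Relation.Binary.PropositionalEquality
  using (_≡_; refl; sym; trans; cong; cong₂; subst)

open Equivalence

_∈?_ : (a : Seq) (T : DecSubset) → Dec (a ∈ᵈ T)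
a ∈? T = T a ≟ true

uniform-weaken : ∀ {T : DecSubset} {P P′ : Subset} →
  P′ ⊆ T → (∀ a → P a → P′ a) → IsUniformBar T P → IsUniformBar T P′
uniform-weaken P′⊆T P⇒P′ (_ , N , uniform) = P′⊆T , N , λ α path →
  let (n , n≤N , p) = uniform α path in n , n≤N , P⇒P′ _ p

module Restriction (T : DecSubset) (P : Subset) where

  Π⁰₁-restrict : IsΠ⁰₁ universal P → IsΠ⁰₁ T (P ∩ᵈ T)
  Π⁰₁-restrict (B , _ , P⇔B) = B∩T , B∩T⊆T , λ a → mk⇔ (into a) (outof a)
    where
    B∩T : ℕ → DecSubset
    B∩T n a = B n a ∧ T a

    B∩T⊆T : ∀ n a → a ∈ᵈ B∩T n → a ∈ᵈ T
    B∩T⊆T n a = ∧-conicalʳ (B n a) (T a)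

    into : ∀ a → (P ∩ᵈ T) a → ∀ n → a ∈ᵈ B∩T n
    into a (p , t) n = cong₂ _∧_ (to (P⇔B a) p n) t

    outof : ∀ a → (∀ n → a ∈ᵈ B∩T n) → (P ∩ᵈ T) a
    outof a h = from (P⇔B a) (λ n → ∧-conicalˡ (B n a) (T a) (h n))
              , B∩T⊆T 0 a (h 0)

  monotone-restrict : IsMonotone universal P → IsMonotone T (P ∩ᵈ T)
  monotone-restrict mono a b (p , _) ab∈T = mono a b p refl , ab∈T

  bar-restrict : IsBar universal P → IsBar T (P ∩ᵈ T)
  bar-restrict (_ , bar) = (λ _ → proj₂) , λ α path →
    let (n , p) = bar α (λ _ → refl) in n , p , path n

FAN⇒FAN* : (T : DecSubset) → Π⁰₁-FAN-M T → Π⁰₁-FAN*-M T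
FAN⇒FAN* T fan P Π mono bar =
  fan (P ∩ᵈ T) (Π⁰₁-restrict Π) (monotone-restrict mono) (bar-restrict bar)
  where open Restriction T P

module Retraction {T : DecSubset} (S : IsSpread T) where
  open IsSpread S
  open IsTree isTree

  root∈T : [] ∈ᵈ T
  root∈T = let (a , a∈T) = inhabited in closed [] a a∈T

  outside-upward : ∀ a b → ¬ (a ∈ᵈ T) → ¬ ((a ++ b) ∈ᵈ T)
  outside-upward a b a∉T ab∈T = a∉T (closed a b ab∈T)

  -- A successor of s inside T whenever s ∈ T (the value for s ∉ T is irrelevant).
  default : Seq → ℕ
  default s with s ∈? T
  ... | yes s∈T = proj₁ (extend s s∈T)
  ... | no  _   = 0

  default∈T : ∀ s → s ∈ᵈ T → (s ++ [ default s ]) ∈ᵈ T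
  default∈T s s∈T with s ∈? T
  ... | yes s∈T′ = proj₂ (extend s s∈T′)
  ... | no  s∉T  = contradiction s∈T s∉T

  step : Seq → ℕ → ℕ
  step s x with (s ++ [ x ]) ∈? T
  ... | yes _ = x
  ... | no  _ = default s

  step∈T : ∀ s x → s ∈ᵈ T → (s ++ [ step s x ]) ∈ᵈ T
  step∈T s x s∈T with (s ++ [ x ]) ∈? T
  ... | yes sx∈T = sx∈T
  ... | no  _    = default∈T s s∈T

  module _ (α : ℕ → ℕ) where

    prefix : ℕ → Seq
    prefix zero    = []
    prefix (suc n) = prefix n ++ [ step (prefix n) (α n) ]

    retract : ℕ → ℕ
    retract n = step (prefix n) (α n)

    initSeg-retract : ∀ n → initSeg retract n ≡ prefix n
    initSeg-retract zero    = refl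
    initSeg-retract (suc n) = cong (_++ [ retract n ]) (initSeg-retract n)

    prefix∈T : ∀ n → prefix n ∈ᵈ T
    prefix∈T zero    = root∈T
    prefix∈T (suc n) = step∈T (prefix n) (α n) (prefix∈T n)

    retract-path : IsPath T retract
    retract-path n = subst (_∈ᵈ T) (sym (initSeg-retract n)) (prefix∈T n)

    agree-or-leave : ∀ n → (initSeg α n ≡ prefix n) ⊎ (∃[ j ] ¬ (initSeg α j ∈ᵈ T))
    agree-or-leave zero = inj₁ refl
    agree-or-leave (suc n) with agree-or-leave n
    ... | inj₂ left = inj₂ left
    ... | inj₁ same with (prefix n ++ [ α n ]) ∈? T
    ...   | yes _   = inj₁ (cong (_++ [ α n ]) same)
    ...   | no  out = inj₂ (suc n , subst (λ s → ¬ ((s ++ [ α n ]) ∈ᵈ T)) (sym same) out)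

module Completion {T : DecSubset} (S : IsSpread T) (P : Subset) where
  open Retraction S

  completion : Subset
  completion a = P a ⊎ ¬ (a ∈ᵈ T)

  Π⁰₁-completion : IsΠ⁰₁ T P → IsΠ⁰₁ universal completion
  Π⁰₁-completion (B , _ , P⇔B) = C , (λ _ _ _ → refl) , λ a → mk⇔ (into a) (outof a)
    where
    C : ℕ → DecSubset
    C n a = not (T a) ∨ B n a

    into : ∀ a → completion a → ∀ n → a ∈ᵈ C n
    into a (inj₁ p) n = trans (cong (not (T a) ∨_) (to (P⇔B a) p n)) (∨-zeroʳ (not (T a)))
    into a (inj₂ a∉T) n with T a
    ... | true  = contradiction refl a∉T
    ... | false = refl

    outof : ∀ a → (∀ n → a ∈ᵈ C n) → completion a
    outof a h with T a
    ... | true  = inj₁ (from (P⇔B a) h)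
    ... | false = inj₂ (λ ())

  monotone-completion : IsMonotone T P → IsMonotone universal completion
  monotone-completion mono a b (inj₂ a∉T) _ = inj₂ (outside-upward a b a∉T)
  monotone-completion mono a b (inj₁ p)   _ with (a ++ b) ∈? T
  ... | yes ab∈T = inj₁ (mono a b p ab∈T)
  ... | no  ab∉T = inj₂ ab∉T

  bar-completion : IsBar T P → IsBar universal completion
  bar-completion (_ , bar) = (λ _ _ → refl) , λ α _ → meets α
    where
    meets : ∀ α → ∃[ n ] completion (initSeg α n)
    meets α with bar (retract α) (retract-path α)
    ... | n , p with agree-or-leave α n
    ...   | inj₁ same      = n , inj₁ (subst P (trans (initSeg-retract α n) (sym same)) p)
    ...   | inj₂ (j , out) = j , inj₂ out

  completion∩T⊆P : ∀ a → (completion ∩ᵈ T) a → P a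
  completion∩T⊆P a (inj₁ p    , _)   = p
  completion∩T⊆P a (inj₂ a∉T , a∈T) = contradiction a∈T a∉T

FAN*⇒FAN : {T : DecSubset} → IsSpread T → Π⁰₁-FAN*-M T → Π⁰₁-FAN-M T
FAN*⇒FAN S fan* P Π mono bar@(P⊆T , _) =
  uniform-weaken P⊆T completion∩T⊆P
    (fan* completion (Π⁰₁-completion Π) (monotone-completion mono) (bar-completion bar))
  where open Completion S P

proposition2p1 : (T : Fan) → Π⁰₁-FAN-M (Fan.tree T) ⇔ Π⁰₁-FAN*-M (Fan.tree T)
proposition2p1 T =
  mk⇔ (FAN⇒FAN* (Fan.tree T)) (FAN*⇒FAN (IsFan.isSpread (Fan.isFan T)))
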